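{- Let $H:\mathbf{CPO}\to\mathbf{CPO}$ be a locally continuous functor and let $\alpha:HA\to A$ be an $H$-algebra such that $A$ has a least element $\bot$. Then $(A,\alpha,(-)^\dagger)$ is a complete Elgot algebra, where $(-)^\dagger$ assigns to every flat equation morphism $e$ in $A$ its least solution $e^\dagger$ (least with respect to the pointwise order on $\mathbf{CPO}(X,A)$).
   Context: $\mathbf{CPO}$ is the category of $\omega$-complete posets (posets with joins of increasing $\omega$-chains) and continuous maps (preserving such joins); coproducts are disjoint unions with elements of different summands incomparable, injections $\mathrm{inl},\mathrm{inr}$. $H$ is locally continuous if $H(\bigsqcup f_n)=\bigsqcup Hf_n$ for every increasing $\omega$-chain $f_n:X\to Y$ in the pointwise order. A flat equation morphism in $A$ is a morphism $e:X\to HX+A$; a solution is $e^\dagger:X\to A$ with $e^\dagger=[\alpha,\mathrm{id}_A]\cdot(He^\dagger+\mathrm{id}_A)\cdot e$. For $e:X\to HX+Y$ and $h:Y\to Z$, $h\bullet e:=(\mathrm{id}_{HX}+h)\cdot e$. For $e:X\to HX+Y$, $f:Y\to HY+A$, $f\oplus e:=(\mathrm{can}+\mathrm{id}_A)\cdot(\mathrm{id}_{HX}+f)\cdot[e,\mathrm{inr}]:X+Y\to H(X+Y)+A$ with $\mathrm{can}=[H\mathrm{inl},H\mathrm{inr}]$. A complete Elgot algebra is an $H$-algebra with an assignment $e\mapsto e^\dagger$ of a solution to every flat equation morphism such that (functoriality) $e^\dagger=f^\dagger\cdot h$ whenever $e:X\to HX+A$, $f:Y\to HY+A$ and $h:X\to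 Y$ satisfy $(Hh+\mathrm{id}_A)\cdot e=f\cdot h$, and (compositionality) $(f^\dagger\bullet e)^\dagger=(f\oplus e)^\dagger\cdot\mathrm{inl}$ for all $e:X\to HX+Y$, $f:Y\to HY+A$. -}

module Defs where

open import Level using (Level) renaming (suc to lsuc)
open import Data.Nat.Base using (ℕ; zero; suc)
open import Data.Unit.Base using (⊤; tt)
open import Data.Empty using (⊥)
open import Data.Product.Base using (Σ; _×_; _,_; proj₁; proj₂)
open import Data.Sum.Base using (_⊎_; inj₁; inj₂)
open import Data.Sum.Relation.Binary.Pointwise using (Pointwise; inj₁; inj₂; ⊎-poset)
open import Relation.Binary.Bundles using (Poset)
open import Relation.Binary.PropositionalEquality using (_≡_; refl; subst; sym)

module _ {ℓ : Level} (P : Poset ℓ ℓ ℓ) where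
  open Poset P

  IsChain : (ℕ → Carrier) → Set ℓ
  IsChain c = ∀ n → c n ≤ c (suc n)

  IsUpperBound : (ℕ → Carrier) → Carrier → Set ℓ
  IsUpperBound c x = ∀ n → c n ≤ x

  IsLub : (ℕ → Carrier) → Carrier → Set ℓ
  IsLub c x = IsUpperBound c x × (∀ y → IsUpperBound c y → x ≤ y)

record CPO (ℓ : Level) : Set (lsuc ℓ) where
  field
    poset : Poset ℓ ℓ ℓ
  open Poset poset public
  field
    ⨆     : (c : ℕ → Carrier) → IsChain poset c → Carrier
    ⨆-lub : (c : ℕ → Carrier) (ch : IsChain poset c) → IsLub poset c (⨆ c ch)

record Hom {ℓ : Level} (X Y : CPO ℓ) : Set ℓ where
  private
    module X = CPO X
    module Y = CPO Y
  field
    fun  : X.Carrier → Y.Carrier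
    mono : ∀ {x y} → x X.≤ y → fun x Y.≤ fun y
    cont : (c : ℕ → X.Carrier) (ch : IsChain X.poset c) →
           IsLub Y.poset (λ n → fun (c n)) (fun (X.⨆ c ch))
open Hom public

module _ {ℓ : Level} {X Y : CPO ℓ} where
  private module Y = CPO Y
  _≐_ : Hom X Y → Hom X Y → Set ℓ
  f ≐ g = ∀ x → fun f x Y.≈ fun g x
  _⊑_ : Hom X Y → Hom X Y → Set ℓ
  f ⊑ g = ∀ x → fun f x Y.≤ fun g x
  infix 4 _≐_ _⊑_

module _ {ℓ : Level} (P : Poset ℓ ℓ ℓ) where
  open Poset P

  lub-unique : ∀ {c a b} → IsLub P c a → IsLub P c b → a ≈ b
  lub-unique (ua , la) (ub , lb) = antisym (la _ ub) (lb _ ua)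

  lub-resp-seq : ∀ {c d a} → (∀ n → c n ≈ d n) → IsLub P c a → IsLub P d a
  lub-resp-seq eq (u , l) =
    (λ n → trans (reflexive (Eq.sym (eq n))) (u n)) ,
    (λ y uy → l y (λ n → trans (reflexive (eq n)) (uy n)))

  lub-resp-val : ∀ {c a b} → a ≈ b → IsLub P c a → IsLub P c b
  lub-resp-val a≈b (u , l) =
    (λ n → trans (u n) (reflexive a≈b)) ,
    (λ y uy → trans (reflexive (Eq.sym a≈b)) (l y uy))

module _ {ℓ : Level} {X Y : CPO ℓ} (f : Hom X Y) where
  private
    module X = CPO X
    module Y = CPO Y
  hom-resp-≈ : ∀ {x y} → x X.≈ y → fun f x Y.≈ fun f y
  hom-resp-≈ x≈y = Y.antisym (mono f (X.reflexive x≈y)) (mono f (X.reflexive (X.Eq.sym x≈y)))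

idH : ∀ {ℓ} {X : CPO ℓ} → Hom X X
idH {X = X} = record { fun = λ x → x ; mono = λ p → p ; cont = CPO.⨆-lub X }

_∘H_ : ∀ {ℓ} {X Y Z : CPO ℓ} → Hom Y Z → Hom X Y → Hom X Z
_∘H_ {X = X} {Y} {Z} g f = record
  { fun  = λ x → fun g (fun f x)
  ; mono = λ p → mono g (mono f p)
  ; cont = λ c ch →
      let chf = λ n → mono f (ch n)
      in lub-resp-val (CPO.poset Z)
           (hom-resp-≈ g (lub-unique (CPO.poset Y) (CPO.⨆-lub Y _ chf) (cont f c ch)))
           (cont g (λ n → fun f (c n)) chf)
  }
infixr 9 _∘H_

-- Coproducts: disjoint union, summands incomparable

module Coproduct {ℓ : Level} (X Y : CPO ℓ) where
  private
    module X = CPO X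
    module Y = CPO Y
  P : Poset ℓ ℓ ℓ
  P = ⊎-poset X.poset Y.poset
  private
    module P = Poset P

  left : X.Carrier ⊎ Y.Carrier → X.Carrier → X.Carrier
  left (inj₁ a) _ = a
  left (inj₂ _) d = d

  right : X.Carrier ⊎ Y.Carrier → Y.Carrier → Y.Carrier
  right (inj₁ _) d = d
  right (inj₂ b) _ = b

  left-mono : ∀ {u v} d → u P.≤ v → left u d X.≤ left v d
  left-mono d (inj₁ p) = p
  left-mono d (inj₂ _) = X.refl

  right-mono : ∀ {u v} d → u P.≤ v → right u d Y.≤ right v d
  right-mono d (inj₁ _) = Y.refl
  right-mono d (inj₂ p) = p

  IsL IsR : X.Carrier ⊎ Y.Carrier → Set
  IsL (inj₁ _) = ⊤
  IsL (inj₂ _) = ⊥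
  IsR (inj₁ _) = ⊥
  IsR (inj₂ _) = ⊤

  IsL-step : ∀ {u v} → u P.≤ v → IsL u → IsL v
  IsL-step (inj₁ _) _ = tt
  IsR-step : ∀ {u v} → u P.≤ v → IsR u → IsR v
  IsR-step (inj₂ _) _ = tt

  IsL-eq : ∀ u d → IsL u → u ≡ inj₁ (left u d)
  IsL-eq (inj₁ _) d _ = refl
  IsR-eq : ∀ u d → IsR u → u ≡ inj₂ (right u d)
  IsR-eq (inj₂ _) d _ = refl

  pick : (c : ℕ → X.Carrier ⊎ Y.Carrier) → IsChain P c →
         X.Carrier ⊎ Y.Carrier → X.Carrier ⊎ Y.Carrier
  pick c ch (inj₁ x) = inj₁ (X.⨆ (λ n → left (c n) x) (λ n → left-mono x (ch n)))
  pick c ch (inj₂ y) = inj₂ (Y.⨆ (λ n → right (c n) y) (λ n → right-mono y (ch n)))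

  ⨆⊎ : (c : ℕ → X.Carrier ⊎ Y.Carrier) → IsChain P c → X.Carrier ⊎ Y.Carrier
  ⨆⊎ c ch = pick c ch (c 0)

  allL : (c : ℕ → X.Carrier ⊎ Y.Carrier) → IsChain P c → IsL (c 0) → ∀ n → IsL (c n)
  allL c ch l zero = l
  allL c ch l (suc n) = IsL-step (ch n) (allL c ch l n)

  allR : (c : ℕ → X.Carrier ⊎ Y.Carrier) → IsChain P c → IsR (c 0) → ∀ n → IsR (c n)
  allR c ch r zero = r
  allR c ch r (suc n) = IsR-step (ch n) (allR c ch r n)

  lubAt : (c : ℕ → X.Carrier ⊎ Y.Carrier) (ch : IsChain P c) (z : X.Carrier ⊎ Y.Carrier) →
          c 0 ≡ z → IsLub P c (pick c ch z)
  lubAt c ch (inj₁ x) eq =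
    (λ n → subst (λ w → w P.≤ inj₁ L) (sym (e n)) (inj₁ (proj₁ lub n))) , least
    where
      d = λ n → left (c n) x
      chd = λ n → left-mono x (ch n)
      L = X.⨆ d chd
      lub = X.⨆-lub d chd
      e : ∀ n → c n ≡ inj₁ (d n)
      e n = IsL-eq (c n) x (allL c ch (subst IsL (sym eq) tt) n)
      least : ∀ w → IsUpperBound P c w → inj₁ L P.≤ w
      least (inj₁ w) uw = inj₁ (proj₂ lub w (λ n → un (subst (λ v → v P.≤ inj₁ w) (e n) (uw n))))
        where
          un : ∀ {a b} → inj₁ a P.≤ inj₁ b → a X.≤ b
          un (inj₁ p) = p
      least (inj₂ w) uw = absurd (subst (λ v → v P.≤ inj₂ w) (e 0) (uw 0))
        where
          absurd : ∀ {a} → inj₁ a P.≤ inj₂ w → inj₁ L P.≤ inj₂ w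
          absurd ()
  lubAt c ch (inj₂ y) eq =
    (λ n → subst (λ w → w P.≤ inj₂ L) (sym (e n)) (inj₂ (proj₁ lub n))) , least
    where
      d = λ n → right (c n) y
      chd = λ n → right-mono y (ch n)
      L = Y.⨆ d chd
      lub = Y.⨆-lub d chd
      e : ∀ n → c n ≡ inj₂ (d n)
      e n = IsR-eq (c n) y (allR c ch (subst IsR (sym eq) tt) n)
      least : ∀ w → IsUpperBound P c w → inj₂ L P.≤ w
      least (inj₂ w) uw = inj₂ (proj₂ lub w (λ n → un (subst (λ v → v P.≤ inj₂ w) (e n) (uw n))))
        where
          un : ∀ {a b} → inj₂ a P.≤ inj₂ b → a Y.≤ b
          un (inj₂ p) = p
      least (inj₁ w) uw = absurd (subst (λ v → v P.≤ inj₁ w) (e 0) (uw 0))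
        where
          absurd : ∀ {a} → inj₂ a P.≤ inj₁ w → inj₂ L P.≤ inj₁ w
          absurd ()

  cpo : CPO ℓ
  cpo = record { poset = P ; ⨆ = ⨆⊎ ; ⨆-lub = λ c ch → lubAt c ch (c 0) refl }

_⊕_ : ∀ {ℓ} → CPO ℓ → CPO ℓ → CPO ℓ
X ⊕ Y = Coproduct.cpo X Y
infixr 6 _⊕_

module _ {ℓ : Level} {X Y : CPO ℓ} where
  open Coproduct X Y using (left; right; left-mono; right-mono; lubAt)
  private
    module X = CPO X
    module Y = CPO Y
    module XY = CPO (X ⊕ Y)

  inl : Hom X (X ⊕ Y)
  inl = record
    { fun = inj₁ ; mono = inj₁
    ; cont = λ c ch → lub-resp-val XY.poset XY.Eq.refl (XY.⨆-lub (λ n → inj₁ (c n)) (λ n → inj₁ (ch n))) }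

  inr : Hom Y (X ⊕ Y)
  inr = record
    { fun = inj₂ ; mono = inj₂
    ; cont = λ c ch → lub-resp-val XY.poset XY.Eq.refl (XY.⨆-lub (λ n → inj₂ (c n)) (λ n → inj₂ (ch n))) }

  [_,_]H : ∀ {Z : CPO ℓ} → Hom X Z → Hom Y Z → Hom (X ⊕ Y) Z
  [_,_]H {Z} f g = record { fun = h ; mono = hm ; cont = λ c ch → hc c ch (c 0) refl }
    where
      module Z = CPO Z
      h : X.Carrier ⊎ Y.Carrier → Z.Carrier
      h (inj₁ x) = fun f x
      h (inj₂ y) = fun g y
      hm : ∀ {u v} → u XY.≤ v → h u Z.≤ h v
      hm (inj₁ p) = mono f p
      hm (inj₂ p) = mono g p
      hc : (c : ℕ → X.Carrier ⊎ Y.Carrier) (ch : IsChain XY.poset c) (z : X.Carrier ⊎ Y.Carrier) →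
           c 0 ≡ z → IsLub Z.poset (λ n → h (c n)) (h (Coproduct.pick X Y c ch z))
      hc c ch (inj₁ x) eq =
        lub-resp-seq Z.poset (λ n → Z.Eq.reflexive (cong' (sym (e n))))
          (cont f (λ n → left (c n) x) (λ n → left-mono x (ch n)))
        where
          e : ∀ n → c n ≡ inj₁ (left (c n) x)
          e n = Coproduct.IsL-eq X Y (c n) x
                  (Coproduct.allL X Y c ch (subst (Coproduct.IsL X Y) (sym eq) tt) n)
          cong' : ∀ {u v} → u ≡ v → h u ≡ h v
          cong' refl = refl
      hc c ch (inj₂ y) eq =
        lub-resp-seq Z.poset (λ n → Z.Eq.reflexive (cong' (sym (e n))))
          (cont g (λ n → right (c n) y) (λ n → right-mono y (ch n)))
        where
          e : ∀ n → c n ≡ inj₂ (right (c n) y)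
          e n = Coproduct.IsR-eq X Y (c n) y
                  (Coproduct.allR X Y c ch (subst (Coproduct.IsR X Y) (sym eq) tt) n)
          cong' : ∀ {u v} → u ≡ v → h u ≡ h v
          cong' refl = refl

_+H_ : ∀ {ℓ} {X Y X' Y' : CPO ℓ} → Hom X X' → Hom Y Y' → Hom (X ⊕ Y) (X' ⊕ Y')
f +H g = [ inl ∘H f , inr ∘H g ]H
infixr 7 _+H_

assocH : ∀ {ℓ} {X Y Z : CPO ℓ} → Hom (X ⊕ (Y ⊕ Z)) ((X ⊕ Y) ⊕ Z)
assocH = [ inl ∘H inl , [ inl ∘H inr , inr ]H ]H

record Functor (ℓ : Level) : Set (lsuc ℓ) where
  field
    F₀ : CPO ℓ → CPO ℓ
    F₁ : ∀ {X Y} → Hom X Y → Hom (F₀ X) (F₀ Y)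
    identity     : ∀ {X} → F₁ (idH {X = X}) ≐ idH
    homomorphism : ∀ {X Y Z} {f : Hom X Y} {g : Hom Y Z} → F₁ (g ∘H f) ≐ F₁ g ∘H F₁ f
    F-resp-≐     : ∀ {X Y} {f g : Hom X Y} → f ≐ g → F₁ f ≐ F₁ g
open Functor public

-- H (⨆ fₙ) = ⨆ H fₙ for every increasing ω-chain fₙ in the pointwise order;
-- the join in CPO(X,Y) is the pointwise join, so "f = ⨆ fₙ" means
-- f x is the lub of (fₙ x) for every x.
LocallyContinuous : ∀ {ℓ} → Functor ℓ → Set (lsuc ℓ)
LocallyContinuous {ℓ} H =
  ∀ {X Y : CPO ℓ} (fs : ℕ → Hom X Y) → (∀ n → fs n ⊑ fs (suc n)) →
  (f : Hom X Y) → (∀ x → IsLub (CPO.poset Y) (λ n → fun (fs n) x) (fun f x)) →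
  ∀ y → IsLub (CPO.poset (F₀ H Y)) (λ n → fun (F₁ H (fs n)) y) (fun (F₁ H f) y)

module _ {ℓ : Level} (H : Functor ℓ) {A : CPO ℓ} (α : Hom (F₀ H A) A) where

  IsSolution : ∀ {X : CPO ℓ} → Hom X (F₀ H X ⊕ A) → Hom X A → Set ℓ
  IsSolution e s = s ≐ [ α , idH ]H ∘H (F₁ H s +H idH) ∘H e

  IsLeastSolution : ∀ {X : CPO ℓ} → Hom X (F₀ H X ⊕ A) → Hom X A → Set ℓ
  IsLeastSolution {X} e s = IsSolution e s × ((s' : Hom X A) → IsSolution e s' → s ⊑ s')

  Dagger : Set (lsuc ℓ)
  Dagger = ∀ {X : CPO ℓ} → Hom X (F₀ H X ⊕ A) → Hom X A

  _•_ : ∀ {X Y Z : CPO ℓ} → Hom Y Z → Hom X (F₀ H X ⊕ Y) → Hom X (F₀ H X ⊕ Z)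
  h • e = (idH +H h) ∘H e

  can : ∀ {X Y : CPO ℓ} → Hom (F₀ H X ⊕ F₀ H Y) (F₀ H (X ⊕ Y))
  can = [ F₁ H inl , F₁ H inr ]H

  -- f ⊕ e (with the associativity isomorphism HX+(HY+A) ≅ (HX+HY)+A made explicit)
  _⊕E_ : ∀ {X Y : CPO ℓ} → Hom Y (F₀ H Y ⊕ A) → Hom X (F₀ H X ⊕ Y) →
         Hom (X ⊕ Y) (F₀ H (X ⊕ Y) ⊕ A)
  f ⊕E e = (can +H idH) ∘H assocH ∘H (idH +H f) ∘H [ e , inr ]H

  record IsCompleteElgot (dag : Dagger) : Set (lsuc ℓ) where
    field
      solution : ∀ {X : CPO ℓ} (e : Hom X (F₀ H X ⊕ A)) → IsSolution e (dag e)
      functoriality : ∀ {X Y : CPO ℓ} (e : Hom X (F₀ H X ⊕ A)) (f : Hom Y (F₀ H Y ⊕ A))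
                        (h : Hom X Y) → (F₁ H h +H idH) ∘H e ≐ f ∘H h → dag e ≐ dag f ∘H h
      compositionality : ∀ {X Y : CPO ℓ} (e : Hom X (F₀ H X ⊕ Y)) (f : Hom Y (F₀ H Y ⊕ A)) →
                           dag (dag f • e) ≐ dag (f ⊕E e) ∘H inl

HasLeast : ∀ {ℓ} → CPO ℓ → Set ℓ
HasLeast A = Σ (CPO.Carrier A) λ b → ∀ x → CPO._≤_ A b x

{-# OPTIONS --safe #-}

-- Local continuity makes s ↦ [α , id] ∘ (Hs + id) ∘ e a continuous operator on
-- the function space CPO(X, A), whose fixed points are exactly the solutions of e;
-- since A has a least element, Kleene's theorem gives its least fixed point e†.
-- Functoriality is fixed-point fusion along the strict continuous map (- ∘ h).
-- For compositionality, a map s : X + Y → A solves f ⊕ e iff s ∘ inr solves f and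
-- s ∘ inl solves (s ∘ inr) • e; applying this to (f ⊕ e)† and to [ (f† • e)† , f† ]
-- and using leastness twice gives the two inequalities.
module Submission where

open import Defs
open import Level using (Level)
open import Data.Product.Base using (Σ; _×_; _,_; proj₁; proj₂)
open import Data.Nat.Base using (ℕ; zero; suc)
open import Data.Sum.Base using (inj₁; inj₂)
open import Function.Bundles using (_⇔_; mk⇔; Equivalence)
open import Relation.Binary.Bundles using (Poset)
import Relation.Binary.Reasoning.Setoid as SetoidReasoning
open import Relation.Binary.PropositionalEquality as ≡ using (_≡_)

module _ {ℓ : Level} (P : Poset ℓ ℓ ℓ) where
  open Poset P

  const-isLub : ∀ a → IsLub P (λ _ → a) a
  const-isLub a = (λ _ → refl) , (λ _ ub → ub 0)

  tail-isLub : ∀ {c a} → IsChain P c → IsLub P c a → IsLub P (λ n → c (suc n)) a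
  tail-isLub ch (ub , least) =
    (λ n → ub (suc n)) ,
    (λ y uby → least y λ { zero → trans (ch 0) (uby 0) ; (suc n) → uby n })

hom-preserves-isLub : ∀ {ℓ} {X Y : CPO ℓ} (f : Hom X Y) {c} → IsChain (CPO.poset X) c →
                      ∀ {a} → IsLub (CPO.poset X) c a →
                      IsLub (CPO.poset Y) (λ n → fun f (c n)) (fun f a)
hom-preserves-isLub {X = X} {Y} f {c} ch lub =
  lub-resp-val (CPO.poset Y)
    (hom-resp-≈ f (lub-unique (CPO.poset X) (CPO.⨆-lub X c ch) lub))
    (cont f c ch)

module FunctionSpace {ℓ : Level} (X Y : CPO ℓ) where
  private
    module X = CPO X
    module Y = CPO Y

  poset : Poset ℓ ℓ ℓ
  poset = record
    { Carrier = Hom X Y ; _≈_ = _≐_ ; _≤_ = _⊑_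
    ; isPartialOrder = record
      { isPreorder = record
        { isEquivalence = record
          { refl  = λ _ → Y.Eq.refl
          ; sym   = λ f≐g x → Y.Eq.sym (f≐g x)
          ; trans = λ f≐g g≐h x → Y.Eq.trans (f≐g x) (g≐h x) }
        ; reflexive = λ f≐g x → Y.reflexive (f≐g x)
        ; trans     = λ f⊑g g⊑h x → Y.trans (f⊑g x) (g⊑h x) }
      ; antisym = λ f⊑g g⊑f x → Y.antisym (f⊑g x) (g⊑f x) } }

  isLub-pointwise : ∀ {fs f} → (∀ x → IsLub Y.poset (λ n → fun (fs n) x) (fun f x)) →
                    IsLub poset fs f
  isLub-pointwise lub = (λ n x → proj₁ (lub x) n) , (λ g ub x → proj₂ (lub x) (fun g x) (λ n → ub n x))

  ⨆-pointwise : (fs : ℕ → Hom X Y) → IsChain poset fs → Hom X Y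
  ⨆-pointwise fs ch = record { fun = L ; mono = L-mono ; cont = L-cont }
    where
      L : X.Carrier → Y.Carrier
      L x = Y.⨆ (λ n → fun (fs n) x) (λ n → ch n x)

      L-isLub : ∀ x → IsLub Y.poset (λ n → fun (fs n) x) (L x)
      L-isLub x = Y.⨆-lub _ (λ n → ch n x)

      L-mono : ∀ {x y} → x X.≤ y → L x Y.≤ L y
      L-mono {x} {y} x≤y =
        proj₂ (L-isLub x) (L y) (λ n → Y.trans (mono (fs n) x≤y) (proj₁ (L-isLub y) n))

      -- joins of chains commute: ⨆ₙ fₙ (⨆ₘ cₘ) = ⨆ₙ ⨆ₘ fₙ cₘ = ⨆ₘ ⨆ₙ fₙ cₘ
      L-cont : (c : ℕ → X.Carrier) (chc : IsChain X.poset c) →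
               IsLub Y.poset (λ m → L (c m)) (L (X.⨆ c chc))
      L-cont c chc =
        (λ m → L-mono (proj₁ (X.⨆-lub c chc) m)) ,
        (λ y uby → proj₂ (L-isLub (X.⨆ c chc)) y λ n →
           proj₂ (cont (fs n) c chc) y λ m → Y.trans (proj₁ (L-isLub (c m)) n) (uby m))

  cpo : CPO ℓ
  cpo = record
    { poset = poset
    ; ⨆     = ⨆-pointwise
    ; ⨆-lub = λ fs ch → isLub-pointwise {fs} {⨆-pointwise fs ch} (λ x → Y.⨆-lub _ (λ n → ch n x)) }

  least : HasLeast Y → HasLeast cpo
  least (⊥ , ⊥-least) =
    record { fun = λ _ → ⊥ ; mono = λ _ → Y.refl ; cont = λ _ _ → const-isLub Y.poset ⊥ } ,
    (λ f x → ⊥-least (fun f x))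

_⇒_ : ∀ {ℓ} → CPO ℓ → CPO ℓ → CPO ℓ
X ⇒ Y = FunctionSpace.cpo X Y
infixr 5 _⇒_

precompose : ∀ {ℓ} {X Y Z : CPO ℓ} → Hom X Y → Hom (Y ⇒ Z) (X ⇒ Z)
precompose {X = X} {Y} {Z} h = record
  { fun  = λ s → s ∘H h
  ; mono = λ s⊑s' x → s⊑s' (fun h x)
  ; cont = λ s ch → FunctionSpace.isLub-pointwise X Z {λ n → s n ∘H h} {CPO.⨆ (Y ⇒ Z) s ch ∘H h}
                      λ x → CPO.⨆-lub Z _ (λ n → ch n (fun h x)) }

module Kleene {ℓ : Level} (D : CPO ℓ) (bottom : HasLeast D) (φ : Hom D D) where
  open CPO D

  iterate : ℕ → Carrier
  iterate zero    = proj₁ bottom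
  iterate (suc n) = fun φ (iterate n)

  iterate-chain : IsChain poset iterate
  iterate-chain zero    = proj₂ bottom _
  iterate-chain (suc n) = mono φ (iterate-chain n)

  lfp : Carrier
  lfp = ⨆ iterate iterate-chain

  lfp-isLub : IsLub poset iterate lfp
  lfp-isLub = ⨆-lub iterate iterate-chain

  lfp-fixed : fun φ lfp ≈ lfp
  lfp-fixed = lub-unique poset (cont φ iterate iterate-chain) (tail-isLub poset iterate-chain lfp-isLub)

  lfp-least : ∀ {d} → fun φ d ≤ d → lfp ≤ d
  lfp-least {d} φd≤d = proj₂ lfp-isLub d iterate≤d
    where
      iterate≤d : IsUpperBound poset iterate d
      iterate≤d zero    = proj₂ bottom d
      iterate≤d (suc n) = trans (mono φ (iterate≤d n)) φd≤d

lfp-fusion : ∀ {ℓ} {D E : CPO ℓ} (⊥D : HasLeast D) (⊥E : HasLeast E) {φ : Hom D D} {ψ : Hom E E}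
             (g : Hom D E) → CPO._≈_ E (fun g (proj₁ ⊥D)) (proj₁ ⊥E) →
             (∀ d → CPO._≈_ E (fun g (fun φ d)) (fun ψ (fun g d))) →
             CPO._≈_ E (fun g (Kleene.lfp D ⊥D φ)) (Kleene.lfp E ⊥E ψ)
lfp-fusion {D = D} {E} ⊥D ⊥E {φ} {ψ} g strict commute =
  lub-unique E.poset
    (lub-resp-seq E.poset g-iterate (cont g DK.iterate DK.iterate-chain))
    EK.lfp-isLub
  where
    module E = CPO E
    module DK = Kleene D ⊥D φ
    module EK = Kleene E ⊥E ψ
    g-iterate : ∀ n → fun g (DK.iterate n) E.≈ EK.iterate n
    g-iterate zero    = strict
    g-iterate (suc n) = E.Eq.trans (commute (DK.iterate n)) (hom-resp-≈ ψ (g-iterate n))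

F₁-mono : ∀ {ℓ} (H : Functor ℓ) → LocallyContinuous H →
          ∀ {X Y : CPO ℓ} {f g : Hom X Y} → f ⊑ g → F₁ H f ⊑ F₁ H g
F₁-mono H lc {X} {Y} {f} {g} f⊑g y = proj₁ (lc fg fg-chain g g-isLub y) 0
  where
    module Y = CPO Y
    fg : ℕ → Hom X Y
    fg zero    = f
    fg (suc _) = g
    fg-chain : ∀ n → fg n ⊑ fg (suc n)
    fg-chain zero    = f⊑g
    fg-chain (suc _) _ = Y.refl
    g-isLub : ∀ x → IsLub Y.poset (λ n → fun (fg n) x) (fun g x)
    g-isLub x = (λ { zero → f⊑g x ; (suc _) → Y.refl }) , (λ _ ub → ub 1)

module LeastSolutions {ℓ : Level} (H : Functor ℓ) (lc : LocallyContinuous H)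
                      {A : CPO ℓ} (α : Hom (F₀ H A) A) (bottom : HasLeast A) where
  private module A = CPO A

  step : ∀ {X : CPO ℓ} → Hom X A → Hom (F₀ H X ⊕ A) A
  step s = [ α , idH ]H ∘H (F₁ H s +H idH)

  step-mono : ∀ {X : CPO ℓ} {s s' : Hom X A} → s ⊑ s' → step s ⊑ step s'
  step-mono s⊑s' (inj₁ u) = mono α (F₁-mono H lc s⊑s' u)
  step-mono s⊑s' (inj₂ a) = A.refl

  step-resp-≐ : ∀ {X : CPO ℓ} {s s' : Hom X A} → s ≐ s' → step s ≐ step s'
  step-resp-≐ s≐s' (inj₁ u) = hom-resp-≈ α (F-resp-≐ H s≐s' u)
  step-resp-≐ s≐s' (inj₂ a) = A.Eq.refl

  step-natural : ∀ {X Y : CPO ℓ} (s : Hom Y A) (h : Hom X Y) →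
                 step s ∘H (F₁ H h +H idH) ≐ step (s ∘H h)
  step-natural s h (inj₁ u) = hom-resp-≈ α (CPO.Eq.sym (F₀ H A) (homomorphism H u))
  step-natural s h (inj₂ a) = A.Eq.refl

  step-isLub : ∀ {X : CPO ℓ} (s : ℕ → Hom X A) (ch : ∀ n → s n ⊑ s (suc n)) (t : Hom X A) →
               (∀ x → IsLub A.poset (λ n → fun (s n) x) (fun t x)) →
               ∀ v → IsLub A.poset (λ n → fun (step (s n)) v) (fun (step t) v)
  step-isLub s ch t lub (inj₁ u) = hom-preserves-isLub α (λ n → F₁-mono H lc (ch n) u) (lc s ch t lub u)
  step-isLub s ch t lub (inj₂ a) = const-isLub A.poset a

  -- IsSolution e s unfolds to s ≐ fun (solutionOperator e) s.
  solutionOperator : ∀ {X : CPO ℓ} → Hom X (F₀ H X ⊕ A) → Hom (X ⇒ A) (X ⇒ A)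
  solutionOperator {X} e = record
    { fun  = λ s → step s ∘H e
    ; mono = λ s⊑s' x → step-mono s⊑s' (fun e x)
    ; cont = λ s ch → FunctionSpace.isLub-pointwise X A {λ n → step (s n) ∘H e}
               {step (CPO.⨆ (X ⇒ A) s ch) ∘H e} λ x →
               step-isLub s ch (CPO.⨆ (X ⇒ A) s ch) (λ y → A.⨆-lub _ (λ n → ch n y)) (fun e x) }

  -- Opaque: letting the unifier unfold the Kleene iteration makes type-checking very slow.
  opaque
    dagger : Dagger H α
    dagger {X} e = Kleene.lfp (X ⇒ A) (FunctionSpace.least X A bottom) (solutionOperator e)

    dagger-solution : ∀ {X : CPO ℓ} (e : Hom X (F₀ H X ⊕ A)) → IsSolution H α e (dagger e)
    dagger-solution {X} e x =
      A.Eq.sym (Kleene.lfp-fixed (X ⇒ A) (FunctionSpace.least X A bottom) (solutionOperator e) x)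

    dagger-least : ∀ {X : CPO ℓ} (e : Hom X (F₀ H X ⊕ A)) (s : Hom X A) → IsSolution H α e s →
                   dagger e ⊑ s
    dagger-least {X} e s solves =
      Kleene.lfp-least (X ⇒ A) (FunctionSpace.least X A bottom) (solutionOperator e)
        (λ x → A.reflexive (A.Eq.sym (solves x)))

    functoriality : ∀ {X Y : CPO ℓ} (e : Hom X (F₀ H X ⊕ A)) (f : Hom Y (F₀ H Y ⊕ A)) (h : Hom X Y) →
                    (F₁ H h +H idH) ∘H e ≐ f ∘H h → dagger e ≐ dagger f ∘H h
    functoriality {X} {Y} e f h square x =
      A.Eq.sym (lfp-fusion (FunctionSpace.least Y A bottom) (FunctionSpace.least X A bottom)
                  (precompose h) (λ _ → A.Eq.refl) commute x)
      where
        commute : ∀ s → (step s ∘H f) ∘H h ≐ step (s ∘H h) ∘H e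
        commute s x = A.Eq.trans (hom-resp-≈ (step s) (CPO.Eq.sym (F₀ H Y ⊕ A) (square x)))
                                 (step-natural s h (fun e x))

  module _ {X Y : CPO ℓ} (e : Hom X (F₀ H X ⊕ Y)) (f : Hom Y (F₀ H Y ⊕ A)) where

    ⊕E-inr : ∀ y → fun (_⊕E_ H α f e) (inj₂ y) ≡ fun (F₁ H (inr {X = X}) +H idH {X = A}) (fun f y)
    ⊕E-inr y with fun f y
    ... | inj₁ _ = ≡.refl
    ... | inj₂ _ = ≡.refl

    ⊕E-solution⇔ : (s : Hom (X ⊕ Y) A) (a : Hom X A) (r : Hom Y A) →
                   s ∘H inl ≐ a → s ∘H inr ≐ r → IsSolution H α f r →
                   IsSolution H α (_⊕E_ H α f e) s ⇔ IsSolution H α (_•_ H α r e) a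
    ⊕E-solution⇔ s a r s-inl s-inr r-solves = mk⇔ to from
      where
        inr-step : ∀ y → fun (step s) (fun (_⊕E_ H α f e) (inj₂ y)) A.≈ fun r y
        inr-step y = begin
          fun (step s) (fun (_⊕E_ H α f e) (inj₂ y))     ≡⟨ ≡.cong (fun (step s)) (⊕E-inr y) ⟩
          fun (step s) (fun (F₁ H inr +H idH) (fun f y))  ≈⟨ step-natural s inr (fun f y) ⟩
          fun (step (s ∘H inr)) (fun f y)                 ≈⟨ step-resp-≐ s-inr (fun f y) ⟩
          fun (step r) (fun f y)                          ≈⟨ r-solves y ⟨
          fun r y                                         ∎
          where open SetoidReasoning A.Eq.setoid

        inl-step : ∀ v → fun (step s) (fun ((can H α +H idH) ∘H assocH ∘H (idH +H f)) v)
                           A.≈ fun (step a) (fun (idH +H r) v)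
        inl-step (inj₁ u) = A.Eq.trans (step-natural s inl (inj₁ u)) (step-resp-≐ s-inl (inj₁ u))
        inl-step (inj₂ y) = inr-step y

        to : IsSolution H α (_⊕E_ H α f e) s → IsSolution H α (_•_ H α r e) a
        to s-solves x =
          A.Eq.trans (A.Eq.sym (s-inl x)) (A.Eq.trans (s-solves (inj₁ x)) (inl-step (fun e x)))

        from : IsSolution H α (_•_ H α r e) a → IsSolution H α (_⊕E_ H α f e) s
        from a-solves (inj₁ x) =
          A.Eq.trans (s-inl x) (A.Eq.trans (a-solves x) (A.Eq.sym (inl-step (fun e x))))
        from a-solves (inj₂ y) = A.Eq.trans (s-inr y) (A.Eq.sym (inr-step y))

    compositionality : dagger (_•_ H α (dagger f) e) ≐ dagger (_⊕E_ H α f e) ∘H inl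
    compositionality x = A.antisym (dagger-least k (dagger g ∘H inl) g†-inl-solves x)
                                   (dagger-least g [ dagger k , dagger f ]H copair-solves (inj₁ x))
      where
        k : Hom X (F₀ H X ⊕ A)
        k = _•_ H α (dagger f) e
        g : Hom (X ⊕ Y) (F₀ H (X ⊕ Y) ⊕ A)
        g = _⊕E_ H α f e

        inr-square : (F₁ H inr +H idH) ∘H f ≐ g ∘H inr
        inr-square y = CPO.Eq.reflexive (F₀ H (X ⊕ Y) ⊕ A) (≡.sym (⊕E-inr y))

        g†-inr : dagger g ∘H inr ≐ dagger f
        g†-inr y = A.Eq.sym (functoriality f g inr inr-square y)

        g†-inl-solves : IsSolution H α k (dagger g ∘H inl)
        g†-inl-solves = Equivalence.to
          (⊕E-solution⇔ (dagger g) (dagger g ∘H inl) (dagger f)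
             (λ _ → A.Eq.refl) g†-inr (dagger-solution f))
          (dagger-solution g)

        copair-solves : IsSolution H α g [ dagger k , dagger f ]H
        copair-solves = Equivalence.from
          (⊕E-solution⇔ [ dagger k , dagger f ]H (dagger k) (dagger f)
             (λ _ → A.Eq.refl) (λ _ → A.Eq.refl) (dagger-solution f))
          (dagger-solution k)

proposition3p5 : ∀ {ℓ : Level} (H : Functor ℓ) → LocallyContinuous H →
                 (A : CPO ℓ) (α : Hom (F₀ H A) A) → HasLeast A →
                 Σ (Dagger H α) λ dag →
                   (∀ {X : CPO ℓ} (e : Hom X (F₀ H X ⊕ A)) → IsLeastSolution H α e (dag e)) ×
                   IsCompleteElgot H α dag
proposition3p5 H lc A α bottom =
  dagger ,
  (λ e → dagger-solution e , dagger-least e) ,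
  record { solution         = λ e → dagger-solution e
         ; functoriality    = λ {X} {Y} → functoriality {X} {Y}
         ; compositionality = λ {X} {Y} → compositionality {X} {Y} }
  where open LeastSolutions H lc α bottom
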